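{- Let $k,d$ be positive integers and $a,b,c\in[0,k]^d$. Consider $p^a_{b,c}(m)=\prod_{i=1}^d p^{a_i}_{b_i,c_i}(m)$ as a polynomial in $m$. Then, for $m\ge 3k$, $p^a_{b,c}(m)>0$ if and only if $|b-c|\le a\le b+c$. Moreover, if $p^a_{b,c}$ is nonzero, then $\deg(p^a_{b,c}(m))\le\mathrm{wt}(\min(b,c))$, with equality if and only if $a\le\max(b,c)$. If $\deg(p^a_{b,c}(m))=\mathrm{wt}(b)=\mathrm{wt}(c)$, then $a\le b=c$ and the leading term of $p^a_{b,c}(m)$ is \[\binom{(k)^d-a}{(k)^d-b}\frac{1}{b!}\,m^{\mathrm{wt}(b)}.\]
   Context: For integers $0\le a,b,c\le k$, $p^a_{b,c}(m)$ denotes the structure constant (intersection number) of the Johnson scheme $\mathcal{J}(m,k)$ (on $k$-subsets of an $m$-set, with relations $|u\setminus v|=i$), given by the polynomial in $m$ \[p^a_{b,c}(m)=\sum_i\binom{k-a}{i}\binom{a}{k-b-i}\binom{a}{k-c-i}\binom{m-k-a}{b+c+i-k},\] where $\binom{x}{j}=x(x-1)\cdots(x-j+1)/j!$ for $j\ge0$ and $0$ for $j<0$. Notation for vectors in $[0,k]^d=\{0,\dots,k\}^d$: $a\le b$ iff $a_i\le b_i$ for all $i$; $|a-b|$, $\min(a,b)$, $\max(a,b)$, $a+b$ are coordinatewise; $a!=a_1!\cdots a_d!$; $\binom{a}{b}=\prod_i\binom{a_i}{b_i}$ (understood as $0$ unless $(0)^d\le b\le a$); $\mathrm{wt}(a)=a_1+\dots+a_d$;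 $(x)^d=(x,\dots,x)$. -}

module Defs where

open import Data.Nat as ℕ using (ℕ; zero; suc; _∸_; _≤_; _<_; _+_; _!; _⊓_; _⊔_)
open import Data.Nat.Properties using (_!≢0)
open import Data.Nat.Combinatorics using (_C_)
open import Data.Integer as ℤ using (ℤ; +_; -[1+_])
open import Data.Rational as ℚ using (ℚ; 0ℚ; 1ℚ)
open import Data.List using (List; []; _∷_; map)
open import Data.Fin using (Fin)
import Data.Fin as Fin
open import Data.Product using (_×_; ∃)
open import Relation.Binary.PropositionalEquality using (_≡_)
open import Relation.Nullary using (¬_)

-- Univariate polynomials over ℚ as coefficient lists (lowest degree first)

Poly : Set
Poly = List ℚ

coeff : Poly → ℕ → ℚ
coeff []      _       = 0ℚ
coeff (x ∷ p) zero    = x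
coeff (x ∷ p) (suc n) = coeff p n

infixl 6 _+P_
infixl 7 _*P_

_+P_ : Poly → Poly → Poly
[]      +P q       = q
(x ∷ p) +P []      = x ∷ p
(x ∷ p) +P (y ∷ q) = (x ℚ.+ y) ∷ (p +P q)

scaleP : ℚ → Poly → Poly
scaleP c p = map (c ℚ.*_) p

_*P_ : Poly → Poly → Poly
[]      *P q = []
(x ∷ p) *P q = scaleP x q +P (0ℚ ∷ (p *P q))

constP : ℚ → Poly
constP c = c ∷ []

X : Poly
X = 0ℚ ∷ 1ℚ ∷ []

evalP : Poly → ℚ → ℚ
evalP []      x = 0ℚ
evalP (c ∷ p) x = c ℚ.+ x ℚ.* evalP p x

ℕtoℚ : ℕ → ℚ
ℕtoℚ n = + n ℚ./ 1

NonZeroPoly : Poly → Set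
NonZeroPoly p = ∃ λ j → ¬ (coeff p j ≡ 0ℚ)

Degree : Poly → ℕ → Set
Degree p n = (¬ (coeff p n ≡ 0ℚ)) × (∀ j → n < j → coeff p j ≡ 0ℚ)

fallP : Poly → ℕ → Poly
fallP x zero    = constP 1ℚ
fallP x (suc j) = fallP x j *P (x +P constP (ℚ.- ℕtoℚ j))

binomN : Poly → ℕ → Poly
binomN x j = scaleP ((+ 1 ℚ./ (j !)) {{j !≢0}}) (fallP x j)

binomZ : Poly → ℤ → Poly
binomZ x (+ j)    = binomN x j
binomZ x -[1+ _ ] = []

sumP : ℕ → (ℕ → Poly) → Poly
sumP zero    f = []
sumP (suc n) f = sumP n f +P f n

prodP : (d : ℕ) → (Fin d → Poly) → Poly
prodP zero    f = constP 1ℚ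
prodP (suc d) f = f Fin.zero *P prodP d (λ i → f (Fin.suc i))

-- Structure constant p^a_{b,c}(m) of the Johnson scheme J(m,k), as a
-- polynomial in m.  The summation index i ranges over 0..k: terms with
-- i < 0 or i > k - a vanish because of the factor binom(k-a, i).

pJ : (k a b c : ℕ) → Poly
pJ k a b c = sumP (suc k) λ i →
    binomN (constP (ℕtoℚ (k ∸ a))) i
  *P binomZ (constP (ℕtoℚ a)) (+ k ℤ.- + b ℤ.- + i)
  *P binomZ (constP (ℕtoℚ a)) (+ k ℤ.- + c ℤ.- + i)
  *P binomZ (X +P constP (ℚ.- ℕtoℚ (k + a))) (+ b ℤ.+ + c ℤ.+ + i ℤ.- + k)

pVec : (k d : ℕ) → (a b c : Fin d → ℕ) → Poly
pVec k d a b c = prodP d λ i → pJ k (a i) (b i) (c i)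

wt : {d : ℕ} → (Fin d → ℕ) → ℕ
wt {zero}  v = 0
wt {suc d} v = v Fin.zero + wt (λ i → v (Fin.suc i))

minV maxV : {d : ℕ} → (Fin d → ℕ) → (Fin d → ℕ) → (Fin d → ℕ)
minV u v i = u i ⊓ v i
maxV u v i = u i ⊔ v i

_≤V_ : {d : ℕ} → (Fin d → ℕ) → (Fin d → ℕ) → Set
u ≤V v = ∀ i → u i ≤ v i

-- binom((k)^d - a, (k)^d - b) / b!  =  ∏_i C(k-a_i, k-b_i) / b_i!
leadCoeff : (k d : ℕ) → (a b : Fin d → ℕ) → ℚ
leadCoeff k zero    a b = 1ℚ
leadCoeff k (suc d) a b =
  ((+ ((k ∸ a Fin.zero) C (k ∸ b Fin.zero)) ℚ./ (b Fin.zero !)) {{b Fin.zero !≢0}})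
  ℚ.* leadCoeff k d (λ i → a (Fin.suc i)) (λ i → b (Fin.suc i))

-- Write p^a_{b,c}(m) = Σ_i T_i with
--   T_i = C(k−a, i) C(a, k−b−i) C(a, k−c−i) C(m−k−a, b+c+i−k).
-- Either one of the three constant factors or the last factor vanishes identically, or all three
-- constants are positive binomial coefficients; then T_i has degree b+c+i−k with positive leading
-- coefficient, and T_i(m) > 0 for m ≥ 3k because m−k−a ≥ k ≥ b+c+i−k. The indices i of the second
-- kind exist iff |b−c| ≤ a ≤ b+c, and the largest one is k − max(a,b,c). Hence p^a_{b,c}(m) > 0
-- for m ≥ 3k exactly under this triangle condition, and then p^a_{b,c} has degree
-- b+c−max(a,b,c) ≤ min(b,c), with equality iff a ≤ max(b,c). Over d coordinates degrees add and
-- leading coefficients multiply; total degree wt b = wt c forces every coordinate to have degree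
-- min(b_i,c_i) = b_i = c_i, so a ≤ b = c, the top index is k − b_i and the leading coefficient of
-- each factor is C(k−a_i, k−b_i) / b_i!.

{-# OPTIONS --safe #-}
module Submission where

open import Defs
open import Data.Nat using (ℕ; _≤_; _+_; _*_; ∣_-_∣)
open import Data.Fin using (Fin)
open import Data.Rational using (0ℚ; _<_)
open import Data.Product using (Σ; _×_)
open import Function.Bundles using (_⇔_)
open import Relation.Binary.PropositionalEquality using (_≡_)

open import Data.Empty using (⊥-elim)
import Data.Fin as Fin
open import Data.Integer using (+_)
import Data.Integer as ℤ
import Data.Integer.Properties as ℤₚ
open import Data.Integer.Solver using () renaming (module +-*-Solver to ℤ-Solver)
open import Data.List using ([]; _∷_)
open import Data.Nat as ℕ using (zero; suc; _∸_; _⊓_; _⊔_; _!; z≤n; s≤s; s≤s⁻¹)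
open import Data.Nat.Combinatorics using (_C_; nCk≡nPk/k!)
import Data.Nat.Combinatorics as ℕᶜ
open import Data.Nat.Combinatorics.Base using (_P′_)
open import Data.Nat.Combinatorics.Specification using (nP′k≡n!/[n∸k]!; nPk≡n!/[n∸k]!; k!∣nP′k)
open import Data.Nat.DivMod using (m/n*n≡m)
open import Data.Nat.Properties
open import Data.Product using (_,_; proj₁; proj₂)
open import Data.Rational using (ℚ; 1ℚ)
import Data.Rational as ℚ
import Data.Rational.Properties as ℚₚ
open import Data.Rational.Solver using (module +-*-Solver)
open import Data.Rational.Unnormalised as ℚᵘ using (mkℚᵘ; *≡*)
import Data.Rational.Unnormalised.Properties as ℚᵘₚ
open import Data.Sum using (_⊎_; inj₁; inj₂)
open import Function using (_∘_)
open import Function.Bundles using (mk⇔; Equivalence)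
open import Relation.Binary using (tri<; tri≈; tri>)
open import Relation.Binary.PropositionalEquality
  using (refl; sym; trans; cong; cong₂; subst; module ≡-Reasoning)
open import Relation.Nullary using (¬_; Dec; yes; no)
open import Relation.Nullary.Decidable using (_×-dec_)

open +-*-Solver
open ℤ-Solver using () renaming (solve to ℤsolve; _:+_ to _⊕_; _:*_ to _⊛_; _:=_ to _≐_; con to ℤcon)

-- Polynomial coefficients, top coefficients and degrees

VanishesFrom : Poly → ℕ → Set
VanishesFrom p n = ∀ j → n ≤ j → coeff p j ≡ 0ℚ

IsZeroPoly : Poly → Set
IsZeroPoly p = VanishesFrom p 0

record TopCoeff (p : Poly) (n : ℕ) (α : ℚ) : Set where
  constructor mkTopCoeff
  field
    vanishes-above : VanishesFrom p (suc n)
    coeff-top      : coeff p n ≡ α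

coeff-+P : ∀ p q j → coeff (p +P q) j ≡ coeff p j ℚ.+ coeff q j
coeff-+P []      q       j       = sym (ℚₚ.+-identityˡ _)
coeff-+P (x ∷ p) []      j       = sym (ℚₚ.+-identityʳ _)
coeff-+P (x ∷ p) (y ∷ q) zero    = refl
coeff-+P (x ∷ p) (y ∷ q) (suc j) = coeff-+P p q j

coeff-scaleP : ∀ c p j → coeff (scaleP c p) j ≡ c ℚ.* coeff p j
coeff-scaleP c []      j       = sym (ℚₚ.*-zeroʳ c)
coeff-scaleP c (x ∷ p) zero    = refl
coeff-scaleP c (x ∷ p) (suc j) = coeff-scaleP c p j

coeff-∷-*P : ∀ x p q j →
  coeff ((x ∷ p) *P q) j ≡ x ℚ.* coeff q j ℚ.+ coeff (0ℚ ∷ (p *P q)) j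
coeff-∷-*P x p q j = trans (coeff-+P (scaleP x q) _ j) (cong (ℚ._+ _) (coeff-scaleP x q j))

coeff-0∷ : ∀ p j → IsZeroPoly p → coeff (0ℚ ∷ p) j ≡ 0ℚ
coeff-0∷ p zero    _ = refl
coeff-0∷ p (suc j) z = z j z≤n

isZero-[] : ∀ {p} → p ≡ [] → IsZeroPoly p
isZero-[] refl j _ = refl

vanishesFrom-mono : ∀ p {m n} → m ≤ n → VanishesFrom p m → VanishesFrom p n
vanishesFrom-mono p m≤n v j n≤j = v j (≤-trans m≤n n≤j)

vanishesFrom-+P : ∀ p q n → VanishesFrom p n → VanishesFrom q n → VanishesFrom (p +P q) n
vanishesFrom-+P p q n vp vq j n≤j =
  trans (coeff-+P p q j) (trans (cong₂ ℚ._+_ (vp j n≤j) (vq j n≤j)) (ℚₚ.+-identityʳ 0ℚ))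

vanishesFrom-scaleP : ∀ c p n → VanishesFrom p n → VanishesFrom (scaleP c p) n
vanishesFrom-scaleP c p n v j n≤j =
  trans (coeff-scaleP c p j) (trans (cong (c ℚ.*_) (v j n≤j)) (ℚₚ.*-zeroʳ c))

*P-zeroˡ : ∀ p q → IsZeroPoly p → IsZeroPoly (p *P q)
*P-zeroˡ []      q zp j _ = refl
*P-zeroˡ (x ∷ p) q zp j _ = begin
  coeff ((x ∷ p) *P q) j                      ≡⟨ coeff-∷-*P x p q j ⟩
  x ℚ.* coeff q j ℚ.+ coeff (0ℚ ∷ (p *P q)) j ≡⟨ cong₂ ℚ._+_ (cong (ℚ._* coeff q j) (zp 0 z≤n))
                                                    (coeff-0∷ (p *P q) j (*P-zeroˡ p q λ i _ → zp (suc i) z≤n)) ⟩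
  0ℚ ℚ.* coeff q j ℚ.+ 0ℚ                    ≡⟨ solve 1 (λ y → con 0ℚ :* y :+ con 0ℚ := con 0ℚ) refl (coeff q j) ⟩
  0ℚ                                          ∎
  where open ≡-Reasoning

*P-zeroʳ : ∀ p q → IsZeroPoly q → IsZeroPoly (p *P q)
*P-zeroʳ []      q zq j _ = refl
*P-zeroʳ (x ∷ p) q zq j _ = begin
  coeff ((x ∷ p) *P q) j                      ≡⟨ coeff-∷-*P x p q j ⟩
  x ℚ.* coeff q j ℚ.+ coeff (0ℚ ∷ (p *P q)) j ≡⟨ cong₂ ℚ._+_ (cong (x ℚ.*_) (zq j z≤n))
                                                    (coeff-0∷ (p *P q) j (*P-zeroʳ p q zq)) ⟩
  x ℚ.* 0ℚ ℚ.+ 0ℚ                            ≡⟨ solve 1 (λ y → y :* con 0ℚ :+ con 0ℚ := con 0ℚ) refl x ⟩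
  0ℚ                                          ∎
  where open ≡-Reasoning

topCoeff-*P : ∀ {p q m n α β} → TopCoeff p m α → TopCoeff q n β → TopCoeff (p *P q) (m + n) (α ℚ.* β)
topCoeff-*P {[]} {β = β} (mkTopCoeff _ pₘ) _ =
  mkTopCoeff (λ _ _ → refl) (trans (sym (ℚₚ.*-zeroˡ β)) (cong (ℚ._* β) pₘ))
topCoeff-*P {x ∷ p} {q} {zero} {n} {α} {β} (mkTopCoeff vp x≡α) (mkTopCoeff vq qₙ) = mkTopCoeff vanish top
  where
  tail0 : IsZeroPoly (p *P q)
  tail0 = *P-zeroˡ p q (λ j _ → vp (suc j) (s≤s z≤n))
  coeff≡ : ∀ j → coeff ((x ∷ p) *P q) j ≡ x ℚ.* coeff q j
  coeff≡ j = trans (coeff-∷-*P x p q j)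
    (trans (cong (x ℚ.* coeff q j ℚ.+_) (coeff-0∷ (p *P q) j tail0)) (ℚₚ.+-identityʳ _))
  vanish : VanishesFrom ((x ∷ p) *P q) (suc n)
  vanish j n<j = trans (coeff≡ j) (trans (cong (x ℚ.*_) (vq j n<j)) (ℚₚ.*-zeroʳ x))
  top : coeff ((x ∷ p) *P q) n ≡ α ℚ.* β
  top = trans (coeff≡ n) (cong₂ ℚ._*_ x≡α qₙ)
topCoeff-*P {x ∷ p} {q} {suc m} {n} {α} {β} (mkTopCoeff vp pₘ) tq@(mkTopCoeff vq _) =
  mkTopCoeff vanish top
  where
  ih : TopCoeff (p *P q) (m + n) (α ℚ.* β)
  ih = topCoeff-*P {p} (mkTopCoeff (λ j m<j → vp (suc j) (s≤s m<j)) pₘ) tq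
  coeff≡ : ∀ j → n ≤ j → coeff ((x ∷ p) *P q) (suc j) ≡ coeff (p *P q) j
  coeff≡ j n≤j = begin
    coeff ((x ∷ p) *P q) (suc j)               ≡⟨ coeff-∷-*P x p q (suc j) ⟩
    x ℚ.* coeff q (suc j) ℚ.+ coeff (p *P q) j ≡⟨ cong (λ c → x ℚ.* c ℚ.+ coeff (p *P q) j)
                                                     (vq (suc j) (s≤s n≤j)) ⟩
    x ℚ.* 0ℚ ℚ.+ coeff (p *P q) j             ≡⟨ solve 2 (λ x y → x :* con 0ℚ :+ y := y)
                                                     refl x (coeff (p *P q) j) ⟩
    coeff (p *P q) j                           ∎
    where open ≡-Reasoning
  vanish : VanishesFrom ((x ∷ p) *P q) (suc (suc m + n))
  vanish (suc j) (s≤s m+n<j) =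
    trans (coeff≡ j (≤-trans (m≤n+m n (suc m)) m+n<j)) (TopCoeff.vanishes-above ih j m+n<j)
  top : coeff ((x ∷ p) *P q) (suc m + n) ≡ α ℚ.* β
  top = trans (coeff≡ (m + n) (m≤n+m n m)) (TopCoeff.coeff-top ih)

topCoeff-+P : ∀ {p q n α β} → TopCoeff p n α → TopCoeff q n β → TopCoeff (p +P q) n (α ℚ.+ β)
topCoeff-+P {p} {q} {n} (mkTopCoeff vp pₙ) (mkTopCoeff vq qₙ) =
  mkTopCoeff (vanishesFrom-+P p q (suc n) vp vq) (trans (coeff-+P p q n) (cong₂ ℚ._+_ pₙ qₙ))

topCoeff-scaleP : ∀ c {p n α} → TopCoeff p n α → TopCoeff (scaleP c p) n (c ℚ.* α)
topCoeff-scaleP c {p} {n} (mkTopCoeff vp pₙ) =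
  mkTopCoeff (vanishesFrom-scaleP c p (suc n) vp) (trans (coeff-scaleP c p n) (cong (c ℚ.*_) pₙ))

topCoeff-cong : ∀ {p m n α β} → m ≡ n → α ≡ β → TopCoeff p m α → TopCoeff p n β
topCoeff-cong refl refl t = t

vanishesFrom⇒topCoeff : ∀ {p n} → VanishesFrom p n → TopCoeff p n 0ℚ
vanishesFrom⇒topCoeff {p} {n} v = mkTopCoeff (vanishesFrom-mono p (n≤1+n n) v) (v n ≤-refl)

topCoeff⇒vanishesFrom : ∀ {p n} → TopCoeff p n 0ℚ → VanishesFrom p n
topCoeff⇒vanishesFrom {p} {n} (mkTopCoeff v pₙ) j n≤j with m≤n⇒m<n∨m≡n n≤j
... | inj₁ n<j  = v j n<j
... | inj₂ refl = pₙ

topCoeff-constP : ∀ c → TopCoeff (constP c) 0 c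
topCoeff-constP c = mkTopCoeff (λ { (suc j) _ → refl }) refl

topCoeff-X+constP : ∀ c → TopCoeff (X +P constP c) 1 1ℚ
topCoeff-X+constP c = mkTopCoeff (λ { (suc (suc j)) _ → refl ; (suc zero) (s≤s ()) }) (ℚₚ.+-identityʳ 1ℚ)

topCoeff⇒degree : ∀ {p n α} → TopCoeff p n α → ¬ α ≡ 0ℚ → Degree p n
topCoeff⇒degree (mkTopCoeff v pₙ) α≢0 = (λ pₙ≡0 → α≢0 (trans (sym pₙ) pₙ≡0)) , v

degree-unique : ∀ p {m n} → Degree p m → Degree p n → m ≡ n
degree-unique p {m} {n} (pₘ≢0 , vm) (pₙ≢0 , vn) with <-cmp m n
... | tri< m<n _ _ = ⊥-elim (pₙ≢0 (vm n m<n))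
... | tri≈ _ m≡n _ = m≡n
... | tri> _ _ n<m = ⊥-elim (pₘ≢0 (vn m n<m))

nonZero⇒¬isZero : ∀ {p} → NonZeroPoly p → ¬ IsZeroPoly p
nonZero⇒¬isZero (j , pⱼ≢0) z = pⱼ≢0 (z j z≤n)

evalP-+P : ∀ p q v → evalP (p +P q) v ≡ evalP p v ℚ.+ evalP q v
evalP-+P []      q       v = sym (ℚₚ.+-identityˡ _)
evalP-+P (x ∷ p) []      v = sym (ℚₚ.+-identityʳ _)
evalP-+P (x ∷ p) (y ∷ q) v = trans (cong (λ e → (x ℚ.+ y) ℚ.+ v ℚ.* e) (evalP-+P p q v))
  (solve 5 (λ x y v e f → (x :+ y) :+ v :* (e :+ f) := (x :+ v :* e) :+ (y :+ v :* f))
     refl x y v (evalP p v) (evalP q v))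

evalP-scaleP : ∀ c p v → evalP (scaleP c p) v ≡ c ℚ.* evalP p v
evalP-scaleP c []      v = sym (ℚₚ.*-zeroʳ c)
evalP-scaleP c (x ∷ p) v = trans (cong (λ e → c ℚ.* x ℚ.+ v ℚ.* e) (evalP-scaleP c p v))
  (solve 4 (λ c x v e → c :* x :+ v :* (c :* e) := c :* (x :+ v :* e)) refl c x v (evalP p v))

evalP-*P : ∀ p q v → evalP (p *P q) v ≡ evalP p v ℚ.* evalP q v
evalP-*P []      q v = sym (ℚₚ.*-zeroˡ (evalP q v))
evalP-*P (x ∷ p) q v = begin
  evalP (scaleP x q +P (0ℚ ∷ (p *P q))) v               ≡⟨ evalP-+P (scaleP x q) (0ℚ ∷ (p *P q)) v ⟩
  evalP (scaleP x q) v ℚ.+ (0ℚ ℚ.+ v ℚ.* evalP (p *P q) v) ≡⟨ cong₂ (λ e f → e ℚ.+ (0ℚ ℚ.+ v ℚ.* f))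
                                                              (evalP-scaleP x q v) (evalP-*P p q v) ⟩
  x ℚ.* eq ℚ.+ (0ℚ ℚ.+ v ℚ.* (evalP p v ℚ.* eq))         ≡⟨ solve 4 (λ x v e f → x :* f :+ (con 0ℚ :+ v :* (e :* f))
                                                                        := (x :+ v :* e) :* f) refl x v (evalP p v) eq ⟩
  (x ℚ.+ v ℚ.* evalP p v) ℚ.* eq                         ∎
  where
  open ≡-Reasoning
  eq = evalP q v

evalP-isZero : ∀ p v → IsZeroPoly p → evalP p v ≡ 0ℚ
evalP-isZero []      v z = refl
evalP-isZero (x ∷ p) v z =
  trans (cong₂ (λ e f → e ℚ.+ v ℚ.* f) (z 0 z≤n) (evalP-isZero p v λ j _ → z (suc j) z≤n))
        (solve 1 (λ v → con 0ℚ :+ v :* con 0ℚ := con 0ℚ) refl v)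

evalP-constant : ∀ p v {α} → TopCoeff p 0 α → evalP p v ≡ α
evalP-constant []      v (mkTopCoeff _ 0≡α) = 0≡α
evalP-constant (x ∷ p) v (mkTopCoeff vp x≡α) =
  trans (cong (λ e → x ℚ.+ v ℚ.* e) (evalP-isZero p v λ j _ → vp (suc j) (s≤s z≤n)))
        (trans (solve 2 (λ x v → x :+ v :* con 0ℚ := x) refl x v) x≡α)

evalP-constP : ∀ c v → evalP (constP c) v ≡ c
evalP-constP c v = evalP-constant (constP c) v (topCoeff-constP c)

evalP-X : ∀ v → evalP X v ≡ v
evalP-X v = solve 1 (λ v → con 0ℚ :+ v :* (con 1ℚ :+ v :* con 0ℚ) := v) refl v

sumP-vanishesFrom : ∀ n f d → (∀ i → i ℕ.< n → VanishesFrom (f i) d) → VanishesFrom (sumP n f) d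
sumP-vanishesFrom zero    f d _ j _ = refl
sumP-vanishesFrom (suc n) f d v =
  vanishesFrom-+P (sumP n f) (f n) d (sumP-vanishesFrom n f d λ i i<n → v i (m<n⇒m<1+n i<n)) (v n ≤-refl)

sumP-topCoeff : ∀ n f t {d α} → t ℕ.< n → TopCoeff (f t) d α
  → (∀ i → i ℕ.< n → ¬ i ≡ t → VanishesFrom (f i) d) → TopCoeff (sumP n f) d α
sumP-topCoeff (suc n) f t {d} {α} t<1+n top rest with m≤n⇒m<n∨m≡n (s≤s⁻¹ t<1+n)
... | inj₂ refl = topCoeff-cong refl (ℚₚ.+-identityˡ α) (topCoeff-+P
    (vanishesFrom⇒topCoeff (sumP-vanishesFrom n f d λ i i<n → rest i (m<n⇒m<1+n i<n) λ i≡n → <-irrefl i≡n i<n))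
    top)
... | inj₁ t<n = topCoeff-cong refl (ℚₚ.+-identityʳ α) (topCoeff-+P
    (sumP-topCoeff n f t t<n top λ i i<n → rest i (m<n⇒m<1+n i<n))
    (vanishesFrom⇒topCoeff (rest n ≤-refl λ n≡t → <-irrefl (sym n≡t) t<n)))

sumP-nonNeg : ∀ n f v → (∀ i → i ℕ.< n → 0ℚ ℚ.≤ evalP (f i) v) → 0ℚ ℚ.≤ evalP (sumP n f) v
sumP-nonNeg zero    f v _  = ℚₚ.≤-refl
sumP-nonNeg (suc n) f v nn = subst (0ℚ ℚ.≤_) (sym (evalP-+P (sumP n f) (f n) v))
  (ℚₚ.+-mono-≤ (sumP-nonNeg n f v λ i i<n → nn i (m<n⇒m<1+n i<n)) (nn n ≤-refl))

sumP-pos : ∀ n f v t → t ℕ.< n → 0ℚ < evalP (f t) v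
  → (∀ i → i ℕ.< n → 0ℚ ℚ.≤ evalP (f i) v) → 0ℚ < evalP (sumP n f) v
sumP-pos (suc n) f v t t<1+n pos nn = subst (0ℚ <_) (sym (evalP-+P (sumP n f) (f n) v)) sum-pos
  where
  sum-pos : 0ℚ < evalP (sumP n f) v ℚ.+ evalP (f n) v
  sum-pos with m≤n⇒m<n∨m≡n (s≤s⁻¹ t<1+n)
  ... | inj₂ refl = ℚₚ.+-mono-≤-< (sumP-nonNeg n f v λ i i<n → nn i (m<n⇒m<1+n i<n)) pos
  ... | inj₁ t<n  = ℚₚ.+-mono-<-≤ (sumP-pos n f v t t<n pos λ i i<n → nn i (m<n⇒m<1+n i<n)) (nn n ≤-refl)

*-pos : ∀ {x y} → 0ℚ < x → 0ℚ < y → 0ℚ < x ℚ.* y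
*-pos {x} {y} 0<x 0<y = ℚₚ.positive⁻¹ (x ℚ.* y) {{ℚₚ.pos*pos⇒pos x {{ℚ.positive 0<x}} y {{ℚ.positive 0<y}}}}

prodℚ : (d : ℕ) → (Fin d → ℚ) → ℚ
prodℚ zero    α = 1ℚ
prodℚ (suc d) α = α Fin.zero ℚ.* prodℚ d (α ∘ Fin.suc)

prodP-isZero : ∀ d f (i : Fin d) → IsZeroPoly (f i) → IsZeroPoly (prodP d f)
prodP-isZero (suc d) f Fin.zero    z = *P-zeroˡ (f Fin.zero) _ z
prodP-isZero (suc d) f (Fin.suc i) z = *P-zeroʳ (f Fin.zero) _ (prodP-isZero d (f ∘ Fin.suc) i z)

prodP-topCoeff : ∀ d f (n : Fin d → ℕ) (α : Fin d → ℚ) → (∀ i → TopCoeff (f i) (n i) (α i))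
  → TopCoeff (prodP d f) (wt n) (prodℚ d α)
prodP-topCoeff zero    f n α _   = topCoeff-constP 1ℚ
prodP-topCoeff (suc d) f n α top =
  topCoeff-*P (top Fin.zero) (prodP-topCoeff d (f ∘ Fin.suc) (n ∘ Fin.suc) (α ∘ Fin.suc) (top ∘ Fin.suc))

prodℚ-pos : ∀ d (α : Fin d → ℚ) → (∀ i → 0ℚ < α i) → 0ℚ < prodℚ d α
prodℚ-pos zero    α _   = ℚₚ.positive⁻¹ 1ℚ
prodℚ-pos (suc d) α pos = *-pos (pos Fin.zero) (prodℚ-pos d (α ∘ Fin.suc) (pos ∘ Fin.suc))

prodP-eval-pos : ∀ d f v → (∀ i → 0ℚ < evalP (f i) v) → 0ℚ < evalP (prodP d f) v
prodP-eval-pos zero    f v _   = subst (0ℚ <_) (sym (evalP-constP 1ℚ v)) (ℚₚ.positive⁻¹ 1ℚ)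
prodP-eval-pos (suc d) f v pos = subst (0ℚ <_) (sym (evalP-*P (f Fin.zero) (prodP d (f ∘ Fin.suc)) v))
  (*-pos (pos Fin.zero) (prodP-eval-pos d (f ∘ Fin.suc) v (pos ∘ Fin.suc)))

prodℚ≡leadCoeff : ∀ k d (a b : Fin d → ℕ) (α : Fin d → ℚ)
  → (∀ i → α i ≡ (+ ((k ∸ a i) C (k ∸ b i)) ℚ./ b i !) {{b i !≢0}}) → prodℚ d α ≡ leadCoeff k d a b
prodℚ≡leadCoeff k zero    a b α _   = refl
prodℚ≡leadCoeff k (suc d) a b α α≡ =
  cong₂ ℚ._*_ (α≡ Fin.zero) (prodℚ≡leadCoeff k d (a ∘ Fin.suc) (b ∘ Fin.suc) (α ∘ Fin.suc) (α≡ ∘ Fin.suc))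

+-injective-≤ : ∀ {m n o p} → m ≤ n → o ≤ p → m + o ≡ n + p → m ≡ n × o ≡ p
+-injective-≤ {m} {n} {o} {p} m≤n o≤p eq with m≤n⇒m<n∨m≡n m≤n
... | inj₂ refl = refl , +-cancelˡ-≡ m o p eq
... | inj₁ m<n  = ⊥-elim (<-irrefl eq (+-mono-<-≤ m<n o≤p))

wt-mono : ∀ {d} (u v : Fin d → ℕ) → (∀ i → u i ≤ v i) → wt u ≤ wt v
wt-mono {zero}  u v _   = z≤n
wt-mono {suc d} u v u≤v = +-mono-≤ (u≤v Fin.zero) (wt-mono (u ∘ Fin.suc) (v ∘ Fin.suc) (u≤v ∘ Fin.suc))

wt-cong : ∀ {d} (u v : Fin d → ℕ) → (∀ i → u i ≡ v i) → wt u ≡ wt v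
wt-cong {zero}  u v _   = refl
wt-cong {suc d} u v u≡v = cong₂ _+_ (u≡v Fin.zero) (wt-cong (u ∘ Fin.suc) (v ∘ Fin.suc) (u≡v ∘ Fin.suc))

wt-injective-≤ : ∀ {d} (u v : Fin d → ℕ) → (∀ i → u i ≤ v i) → wt u ≡ wt v → ∀ i → u i ≡ v i
wt-injective-≤ {suc d} u v u≤v wu≡wv i
  with +-injective-≤ (u≤v Fin.zero) (wt-mono (u ∘ Fin.suc) (v ∘ Fin.suc) (u≤v ∘ Fin.suc)) wu≡wv
wt-injective-≤ {suc d} u v u≤v wu≡wv Fin.zero    | u₀≡v₀ , _ = u₀≡v₀
wt-injective-≤ {suc d} u v u≤v wu≡wv (Fin.suc i) | _ , rest =
  wt-injective-≤ (u ∘ Fin.suc) (v ∘ Fin.suc) (u≤v ∘ Fin.suc) rest i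

m+n∸[m⊔n]≡m⊓n : ∀ m n → m + n ∸ (m ⊔ n) ≡ m ⊓ n
m+n∸[m⊔n]≡m⊓n m n with ≤-total m n
... | inj₁ m≤n = begin
  m + n ∸ (m ⊔ n) ≡⟨ cong (m + n ∸_) (m≤n⇒m⊔n≡n m≤n) ⟩
  m + n ∸ n       ≡⟨ m+n∸n≡m m n ⟩
  m               ≡⟨ m≤n⇒m⊓n≡m m≤n ⟨
  m ⊓ n           ∎
  where open ≡-Reasoning
... | inj₂ n≤m = begin
  m + n ∸ (m ⊔ n) ≡⟨ cong (m + n ∸_) (m≥n⇒m⊔n≡m n≤m) ⟩
  m + n ∸ m       ≡⟨ m+n∸m≡n m n ⟩
  n               ≡⟨ m≥n⇒m⊓n≡n n≤m ⟨
  m ⊓ n           ∎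
  where open ≡-Reasoning

m∸n∸o≤p⇒m≤o+[n+p] : ∀ m n o p → m ∸ n ∸ o ≤ p → m ≤ o + (n + p)
m∸n∸o≤p⇒m≤o+[n+p] m n o p le = begin
  m                 ≤⟨ m≤n+m∸n m (n + o) ⟩
  n + o + (m ∸ (n + o)) ≤⟨ +-monoʳ-≤ (n + o) (subst (_≤ p) (∸-+-assoc m n o) le) ⟩
  n + o + p         ≡⟨ cong (_+ p) (+-comm n o) ⟩
  o + n + p         ≡⟨ +-assoc o n p ⟩
  o + (n + p)       ∎
  where open ≤-Reasoning

Triangle : ℕ → ℕ → ℕ → Set
Triangle a b c = ∣ b - c ∣ ≤ a × a ≤ b + c

triangle? : ∀ a b c → Dec (Triangle a b c)
triangle? a b c = (∣ b - c ∣ ≤? a) ×-dec (a ≤? b + c)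

triangle⇒≤+ : ∀ {a b c} → Triangle a b c → b ≤ c + a × c ≤ b + a
triangle⇒≤+ {a} {b} {c} (∣b-c∣≤a , _) =
  ≤-trans (m≤n+∣m-n∣ b c) (+-monoʳ-≤ c ∣b-c∣≤a) ,
  ≤-trans (m≤n+∣n-m∣ c b) (+-monoʳ-≤ b ∣b-c∣≤a)

≤+⇒triangle : ∀ {a b c} → b ≤ c + a → c ≤ b + a → a ≤ b + c → Triangle a b c
≤+⇒triangle {a} {b} {c} b≤c+a c≤b+a a≤b+c with ≤-total b c
... | inj₁ b≤c = subst (_≤ a) (sym (m≤n⇒∣m-n∣≡n∸m b≤c)) (m≤n+o⇒m∸n≤o c b c≤b+a) , a≤b+c
... | inj₂ c≤b = subst (_≤ a) (sym (m≤n⇒∣n-m∣≡n∸m c≤b)) (m≤n+o⇒m∸n≤o b c b≤c+a) , a≤b+c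

-- ℕtoℚ n normalises + n / 1, which does not compute for a variable n; hence the detour through ℚᵘ.
toℚᵘ-ℕtoℚ : ∀ x → ℚ.toℚᵘ (ℕtoℚ x) ℚᵘ.≃ mkℚᵘ (+ x) 0
toℚᵘ-ℕtoℚ x = ℚₚ.toℚᵘ-fromℚᵘ (mkℚᵘ (+ x) 0)

ℕtoℚ-+ : ∀ x y → ℕtoℚ (x + y) ≡ ℕtoℚ x ℚ.+ ℕtoℚ y
ℕtoℚ-+ x y = ℚₚ.toℚᵘ-injective (begin
  ℚ.toℚᵘ (ℕtoℚ (x + y))                 ≈⟨ toℚᵘ-ℕtoℚ (x + y) ⟩
  mkℚᵘ (+ (x + y)) 0                    ≈⟨ *≡* (trans (cong (ℤ._* (+ 1 ℤ.* + 1)) (ℤₚ.pos-+ x y))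
                                             (ℤsolve 2 (λ a b → (a ⊕ b) ⊛ (ℤcon (+ 1) ⊛ ℤcon (+ 1))
                                                ≐ (a ⊛ ℤcon (+ 1) ⊕ b ⊛ ℤcon (+ 1)) ⊛ ℤcon (+ 1)) refl (+ x) (+ y))) ⟩
  mkℚᵘ (+ x) 0 ℚᵘ.+ mkℚᵘ (+ y) 0        ≈⟨ ℚᵘₚ.+-cong (toℚᵘ-ℕtoℚ x) (toℚᵘ-ℕtoℚ y) ⟨
  ℚ.toℚᵘ (ℕtoℚ x) ℚᵘ.+ ℚ.toℚᵘ (ℕtoℚ y) ≈⟨ ℚₚ.toℚᵘ-homo-+ (ℕtoℚ x) (ℕtoℚ y) ⟨
  ℚ.toℚᵘ (ℕtoℚ x ℚ.+ ℕtoℚ y)           ∎)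
  where open ℚᵘₚ.≃-Reasoning

ℕtoℚ-*-/ : ∀ x y n .{{_ : ℕ.NonZero n}} → ℕtoℚ x ℚ.* (+ y ℚ./ n) ≡ + (x * y) ℚ./ n
ℕtoℚ-*-/ x y (suc n) = ℚₚ.toℚᵘ-injective (begin
  ℚ.toℚᵘ (ℕtoℚ x ℚ.* (+ y ℚ./ suc n))         ≈⟨ ℚₚ.toℚᵘ-homo-* (ℕtoℚ x) (+ y ℚ./ suc n) ⟩
  ℚ.toℚᵘ (ℕtoℚ x) ℚᵘ.* ℚ.toℚᵘ (+ y ℚ./ suc n) ≈⟨ ℚᵘₚ.*-cong (toℚᵘ-ℕtoℚ x) (ℚₚ.toℚᵘ-fromℚᵘ (mkℚᵘ (+ y) n)) ⟩
  mkℚᵘ (+ x) 0 ℚᵘ.* mkℚᵘ (+ y) n              ≈⟨ *≡* (ℤsolve 3 (λ a b d → (a ⊛ b) ⊛ d ≐ (a ⊛ b) ⊛ (ℤcon (+ 1) ⊛ d))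
                                                     refl (+ x) (+ y) (+ suc n)) ⟩
  mkℚᵘ (+ x ℤ.* + y) n                        ≡⟨ cong (λ z → mkℚᵘ z n) (ℤₚ.pos-* x y) ⟨
  mkℚᵘ (+ (x * y)) n                          ≈⟨ ℚₚ.toℚᵘ-fromℚᵘ (mkℚᵘ (+ (x * y)) n) ⟨
  ℚ.toℚᵘ (+ (x * y) ℚ./ suc n)                ∎)
  where open ℚᵘₚ.≃-Reasoning

ℕtoℚ-*-1/ : ∀ n .{{_ : ℕ.NonZero n}} → ℕtoℚ n ℚ.* (+ 1 ℚ./ n) ≡ 1ℚ
ℕtoℚ-*-1/ (suc n) = begin
  ℕtoℚ (suc n) ℚ.* (+ 1 ℚ./ suc n) ≡⟨ ℕtoℚ-*-/ (suc n) 1 (suc n) ⟩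
  + (suc n * 1) ℚ./ suc n          ≡⟨ cong (λ m → + m ℚ./ suc n) (*-identityʳ (suc n)) ⟩
  + suc n ℚ./ suc n                ≡⟨ ℚₚ.toℚᵘ-injective (ℚᵘₚ.≃-trans (ℚₚ.toℚᵘ-fromℚᵘ (mkℚᵘ (+ suc n) n))
                                                                  (*≡* (ℤₚ.*-comm (+ suc n) (+ 1)))) ⟩
  1ℚ                               ∎
  where open ≡-Reasoning

ℕtoℚ-* : ∀ x y → ℕtoℚ (x * y) ≡ ℕtoℚ x ℚ.* ℕtoℚ y
ℕtoℚ-* x y = sym (ℕtoℚ-*-/ x y 1)

ℕtoℚ-∸ : ∀ x y → y ≤ x → ℕtoℚ x ℚ.+ ℚ.- ℕtoℚ y ≡ ℕtoℚ (x ∸ y)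
ℕtoℚ-∸ x y y≤x = begin
  ℕtoℚ x ℚ.+ ℚ.- ℕtoℚ y                       ≡⟨ cong (λ z → ℕtoℚ z ℚ.+ ℚ.- ℕtoℚ y) (m∸n+n≡m y≤x) ⟨
  ℕtoℚ (x ∸ y + y) ℚ.+ ℚ.- ℕtoℚ y             ≡⟨ cong (ℚ._+ ℚ.- ℕtoℚ y) (ℕtoℚ-+ (x ∸ y) y) ⟩
  (ℕtoℚ (x ∸ y) ℚ.+ ℕtoℚ y) ℚ.+ ℚ.- ℕtoℚ y    ≡⟨ solve 2 (λ d y → (d :+ y) :+ :- y := d) refl (ℕtoℚ (x ∸ y)) (ℕtoℚ y) ⟩
  ℕtoℚ (x ∸ y)                                ∎
  where open ≡-Reasoning

ℕtoℚ-pos : ∀ n → 0 ℕ.< n → 0ℚ < ℕtoℚ n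
ℕtoℚ-pos (suc n) _ = ℚₚ.positive⁻¹ (ℕtoℚ (suc n)) {{ℚₚ.normalize-pos (suc n) 1}}

-- Falling factorials and binomial coefficients

falling : ℚ → ℕ → ℚ
falling v zero    = 1ℚ
falling v (suc j) = falling v j ℚ.* (v ℚ.+ ℚ.- ℕtoℚ j)

evalP-fallP : ∀ x j v → evalP (fallP x j) v ≡ falling (evalP x v) j
evalP-fallP x zero    v = evalP-constP 1ℚ v
evalP-fallP x (suc j) v = trans (evalP-*P (fallP x j) (x +P constP (ℚ.- ℕtoℚ j)) v)
  (cong₂ ℚ._*_ (evalP-fallP x j v)
               (trans (evalP-+P x (constP (ℚ.- ℕtoℚ j)) v) (cong (evalP x v ℚ.+_) (evalP-constP _ v))))

topCoeff-fallP-constP : ∀ c j → TopCoeff (fallP (constP c) j) 0 (falling c j)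
topCoeff-fallP-constP c zero    = topCoeff-constP 1ℚ
topCoeff-fallP-constP c (suc j) =
  topCoeff-*P (topCoeff-fallP-constP c j) (topCoeff-+P (topCoeff-constP c) (topCoeff-constP (ℚ.- ℕtoℚ j)))

topCoeff-fallP-monic : ∀ {x} → TopCoeff x 1 1ℚ → ∀ j → TopCoeff (fallP x j) j 1ℚ
topCoeff-fallP-monic monic zero    = topCoeff-constP 1ℚ
topCoeff-fallP-monic monic (suc j) = topCoeff-cong (+-comm j 1) refl
  (topCoeff-*P (topCoeff-fallP-monic monic j)
    (topCoeff-cong refl (ℚₚ.+-identityʳ 1ℚ)
      (topCoeff-+P monic (vanishesFrom⇒topCoeff {constP (ℚ.- ℕtoℚ j)} λ { (suc j) _ → refl }))))

falling-ℕ-pos : ∀ M j → j ≤ M → 0ℚ < falling (ℕtoℚ M) j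
falling-ℕ-pos M zero    _   = ℚₚ.positive⁻¹ 1ℚ
falling-ℕ-pos M (suc j) j<M = subst (0ℚ <_) (cong (falling (ℕtoℚ M) j ℚ.*_) (sym (ℕtoℚ-∸ M j (<⇒≤ j<M))))
  (*-pos (falling-ℕ-pos M j (<⇒≤ j<M)) (ℕtoℚ-pos (M ∸ j) (m<n⇒0<n∸m j<M)))

falling-ℕ-zero : ∀ M j → M ℕ.< j → falling (ℕtoℚ M) j ≡ 0ℚ
falling-ℕ-zero M (suc j) M<1+j with m≤n⇒m<n∨m≡n (s≤s⁻¹ M<1+j)
... | inj₁ M<j  = trans (cong (ℚ._* (ℕtoℚ M ℚ.+ ℚ.- ℕtoℚ j)) (falling-ℕ-zero M j M<j))
                        (ℚₚ.*-zeroˡ (ℕtoℚ M ℚ.+ ℚ.- ℕtoℚ j))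
... | inj₂ refl = trans (cong (falling (ℕtoℚ M) M ℚ.*_) (ℚₚ.+-inverseʳ (ℕtoℚ M)))
                        (ℚₚ.*-zeroʳ (falling (ℕtoℚ M) M))

falling-ℕ≡P′ : ∀ M j → j ≤ M → falling (ℕtoℚ M) j ≡ ℕtoℚ (M P′ j)
falling-ℕ≡P′ M zero    _   = refl
falling-ℕ≡P′ M (suc j) j<M = begin
  falling (ℕtoℚ M) j ℚ.* (ℕtoℚ M ℚ.+ ℚ.- ℕtoℚ j) ≡⟨ cong₂ ℚ._*_ (falling-ℕ≡P′ M j (<⇒≤ j<M))
                                                                (ℕtoℚ-∸ M j (<⇒≤ j<M)) ⟩
  ℕtoℚ (M P′ j) ℚ.* ℕtoℚ (M ∸ j)                 ≡⟨ ℚₚ.*-comm (ℕtoℚ (M P′ j)) (ℕtoℚ (M ∸ j)) ⟩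
  ℕtoℚ (M ∸ j) ℚ.* ℕtoℚ (M P′ j)                 ≡⟨ ℕtoℚ-* (M ∸ j) (M P′ j) ⟨
  ℕtoℚ (M P′ suc j)                              ∎
  where open ≡-Reasoning

1/! : ℕ → ℚ
1/! j = (+ 1 ℚ./ j !) {{j !≢0}}

1/!-pos : ∀ j → 0ℚ < 1/! j
1/!-pos j = ℚₚ.positive⁻¹ (1/! j) {{ℚₚ.normalize-pos 1 (j !) {{j !≢0}}}}

nCk*k!≡nP′k : ∀ n k → k ≤ n → (n C k) * k ! ≡ n P′ k
nCk*k!≡nP′k n k k≤n = begin
  (n C k) * k !                         ≡⟨ cong (_* k !) (nCk≡nPk/k! k≤n) ⟩
  ((n ℕᶜ.P k) ℕ./ k !) {{k !≢0}} * k !     ≡⟨ cong (λ p → (p ℕ./ k !) {{k !≢0}} * k !) nPk≡nP′k ⟩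
  ((n P′ k) ℕ./ k !) {{k !≢0}} * k !    ≡⟨ m/n*n≡m {{k !≢0}} (k!∣nP′k k≤n) ⟩
  n P′ k                                ∎
  where
  open ≡-Reasoning
  nPk≡nP′k : n ℕᶜ.P k ≡ n P′ k
  nPk≡nP′k = trans (nPk≡n!/[n∸k]! k≤n) (sym (nP′k≡n!/[n∸k]! k≤n))

binomialℚ : ℕ → ℕ → ℚ
binomialℚ M j = 1/! j ℚ.* falling (ℕtoℚ M) j

binomialℚ≡C : ∀ M j → j ≤ M → binomialℚ M j ≡ ℕtoℚ (M C j)
binomialℚ≡C M j j≤M = begin
  1/! j ℚ.* falling (ℕtoℚ M) j              ≡⟨ cong (1/! j ℚ.*_) (falling-ℕ≡P′ M j j≤M) ⟩
  1/! j ℚ.* ℕtoℚ (M P′ j)                   ≡⟨ cong (λ p → 1/! j ℚ.* ℕtoℚ p) (nCk*k!≡nP′k M j j≤M) ⟨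
  1/! j ℚ.* ℕtoℚ ((M C j) * j !)            ≡⟨ cong (1/! j ℚ.*_) (ℕtoℚ-* (M C j) (j !)) ⟩
  1/! j ℚ.* (ℕtoℚ (M C j) ℚ.* ℕtoℚ (j !))   ≡⟨ solve 3 (λ u c f → u :* (c :* f) := c :* (f :* u)) refl
                                                   (1/! j) (ℕtoℚ (M C j)) (ℕtoℚ (j !)) ⟩
  ℕtoℚ (M C j) ℚ.* (ℕtoℚ (j !) ℚ.* 1/! j)   ≡⟨ cong (ℕtoℚ (M C j) ℚ.*_) (ℕtoℚ-*-1/ (j !) {{j !≢0}}) ⟩
  ℕtoℚ (M C j) ℚ.* 1ℚ                       ≡⟨ ℚₚ.*-identityʳ _ ⟩
  ℕtoℚ (M C j)                              ∎
  where open ≡-Reasoning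

binomialℚ-pos : ∀ M j → j ≤ M → 0ℚ < binomialℚ M j
binomialℚ-pos M j j≤M = *-pos (1/!-pos j) (falling-ℕ-pos M j j≤M)

binomConst : ℕ → ℕ → Poly
binomConst M j = binomN (constP (ℕtoℚ M)) j

topCoeff-binomConst : ∀ M j → TopCoeff (binomConst M j) 0 (binomialℚ M j)
topCoeff-binomConst M j = topCoeff-scaleP (1/! j) (topCoeff-fallP-constP (ℕtoℚ M) j)

binomConst-zero : ∀ M j → M ℕ.< j → IsZeroPoly (binomConst M j)
binomConst-zero M j M<j = topCoeff⇒vanishesFrom
  (topCoeff-cong refl (trans (cong (1/! j ℚ.*_) (falling-ℕ-zero M j M<j)) (ℚₚ.*-zeroʳ (1/! j)))
    (topCoeff-binomConst M j))

evalP-binomConst : ∀ M j v → evalP (binomConst M j) v ≡ binomialℚ M j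
evalP-binomConst M j v = evalP-constant (binomConst M j) v (topCoeff-binomConst M j)

topCoeff-binomN-monic : ∀ {x} → TopCoeff x 1 1ℚ → ∀ j → TopCoeff (binomN x j) j (1/! j)
topCoeff-binomN-monic monic j =
  topCoeff-cong refl (ℚₚ.*-identityʳ (1/! j)) (topCoeff-scaleP (1/! j) (topCoeff-fallP-monic monic j))

evalP-binomN : ∀ x j v → evalP (binomN x j) v ≡ 1/! j ℚ.* falling (evalP x v) j
evalP-binomN x j v = trans (evalP-scaleP (1/! j) (fallP x j) v) (cong (1/! j ℚ.*_) (evalP-fallP x j v))

+-∸-ℤ : ∀ {m n} → n ≤ m → + m ℤ.- + n ≡ + (m ∸ n)
+-∸-ℤ {m} {n} n≤m = trans (ℤₚ.m-n≡m⊖n m n) (ℤₚ.⊖-≥ n≤m)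

binomZ-∸ : ∀ x {n i} → i ≤ n → binomZ x (+ n ℤ.- + i) ≡ binomN x (n ∸ i)
binomZ-∸ x i≤n = cong (binomZ x) (+-∸-ℤ i≤n)

binomZ-< : ∀ x {n i} → n ℕ.< i → binomZ x (+ n ℤ.- + i) ≡ []
binomZ-< x {n} {i} n<i with i ∸ n | m<n⇒0<n∸m n<i | trans (ℤₚ.m-n≡m⊖n n i) (ℤₚ.⊖-< n<i)
... | suc r | _ | n-i≡-[1+r] = cong (binomZ x) n-i≡-[1+r]

-- A single coordinate

module Coordinate {k a b c : ℕ} (a≤k : a ≤ k) (b≤k : b ≤ k) (c≤k : c ≤ k) where

  linear : Poly
  linear = X +P constP (ℚ.- ℕtoℚ (k + a))

  outer : ℕ → Poly
  outer i = binomConst (k ∸ a) i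

  middle : ℕ → ℕ → Poly
  middle x i = binomZ (constP (ℕtoℚ a)) (+ k ℤ.- + x ℤ.- + i)

  inner : ℕ → Poly
  inner i = binomZ linear (+ b ℤ.+ + c ℤ.+ + i ℤ.- + k)

  -- pJ k a b c unfolds to sumP (suc k) term.
  term : ℕ → Poly
  term i = outer i *P middle b i *P middle c i *P inner i

  termDegree : ℕ → ℕ
  termDegree i = b + c + i ∸ k

  constantPart : ℕ → ℚ
  constantPart i = binomialℚ (k ∸ a) i ℚ.* binomialℚ a (k ∸ b ∸ i) ℚ.* binomialℚ a (k ∸ c ∸ i)

  termLead : ℕ → ℚ
  termLead i = constantPart i ℚ.* 1/! (termDegree i)

  record Supported (i : ℕ) : Set where
    field
      i≤k∸a   : i ≤ k ∸ a
      i≤k∸b   : i ≤ k ∸ b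
      k∸b∸i≤a : k ∸ b ∸ i ≤ a
      i≤k∸c   : i ≤ k ∸ c
      k∸c∸i≤a : k ∸ c ∸ i ≤ a
      k≤b+c+i : k ≤ b + c + i

  middle≡binomZ : ∀ {x} i → x ≤ k → middle x i ≡ binomZ (constP (ℕtoℚ a)) (+ (k ∸ x) ℤ.- + i)
  middle≡binomZ i x≤k = cong (λ n → binomZ (constP (ℕtoℚ a)) (n ℤ.- + i)) (+-∸-ℤ x≤k)

  middle-∸ : ∀ {x} i → x ≤ k → i ≤ k ∸ x → middle x i ≡ binomConst a (k ∸ x ∸ i)
  middle-∸ i x≤k i≤k∸x = trans (middle≡binomZ i x≤k) (binomZ-∸ (constP (ℕtoℚ a)) i≤k∸x)

  middle-zero-< : ∀ {x} i → x ≤ k → k ∸ x ℕ.< i → IsZeroPoly (middle x i)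
  middle-zero-< i x≤k k∸x<i = isZero-[] (trans (middle≡binomZ i x≤k) (binomZ-< (constP (ℕtoℚ a)) k∸x<i))

  middle-zero-∸ : ∀ {x} i → x ≤ k → i ≤ k ∸ x → a ℕ.< k ∸ x ∸ i → IsZeroPoly (middle x i)
  middle-zero-∸ {x} i x≤k i≤k∸x a<k∸x∸i =
    subst IsZeroPoly (sym (middle-∸ i x≤k i≤k∸x)) (binomConst-zero a (k ∸ x ∸ i) a<k∸x∸i)

  term-zero-outer : ∀ i → IsZeroPoly (outer i) → IsZeroPoly (term i)
  term-zero-outer i z = *P-zeroˡ (outer i *P middle b i *P middle c i) (inner i)
    (*P-zeroˡ (outer i *P middle b i) (middle c i) (*P-zeroˡ (outer i) (middle b i) z))

  term-zero-middle-b : ∀ i → IsZeroPoly (middle b i) → IsZeroPoly (term i)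
  term-zero-middle-b i z = *P-zeroˡ (outer i *P middle b i *P middle c i) (inner i)
    (*P-zeroˡ (outer i *P middle b i) (middle c i) (*P-zeroʳ (outer i) (middle b i) z))

  term-zero-middle-c : ∀ i → IsZeroPoly (middle c i) → IsZeroPoly (term i)
  term-zero-middle-c i z = *P-zeroˡ (outer i *P middle b i *P middle c i) (inner i)
    (*P-zeroʳ (outer i *P middle b i) (middle c i) z)

  term-zero-inner : ∀ i → IsZeroPoly (inner i) → IsZeroPoly (term i)
  term-zero-inner i z = *P-zeroʳ (outer i *P middle b i *P middle c i) (inner i) z

  term-zero-or-supported : ∀ i → IsZeroPoly (term i) ⊎ Supported i
  term-zero-or-supported i
    with i ≤? k ∸ a | i ≤? k ∸ b | k ∸ b ∸ i ≤? a | i ≤? k ∸ c | k ∸ c ∸ i ≤? a | k ≤? b + c + i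
  ... | no ¬p₁ | _ | _ | _ | _ | _ =
    inj₁ (term-zero-outer i (binomConst-zero (k ∸ a) i (≰⇒> ¬p₁)))
  ... | yes _ | no ¬p₂ | _ | _ | _ | _ =
    inj₁ (term-zero-middle-b i (middle-zero-< i b≤k (≰⇒> ¬p₂)))
  ... | yes _ | yes p₂ | no ¬p₃ | _ | _ | _ =
    inj₁ (term-zero-middle-b i (middle-zero-∸ i b≤k p₂ (≰⇒> ¬p₃)))
  ... | yes _ | yes _ | yes _ | no ¬p₄ | _ | _ =
    inj₁ (term-zero-middle-c i (middle-zero-< i c≤k (≰⇒> ¬p₄)))
  ... | yes _ | yes _ | yes _ | yes p₄ | no ¬p₅ | _ =
    inj₁ (term-zero-middle-c i (middle-zero-∸ i c≤k p₄ (≰⇒> ¬p₅)))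
  ... | yes _ | yes _ | yes _ | yes _ | yes _ | no ¬p₆ =
    inj₁ (term-zero-inner i (isZero-[] (binomZ-< linear {b + c + i} (≰⇒> ¬p₆))))
  ... | yes p₁ | yes p₂ | yes p₃ | yes p₄ | yes p₅ | yes p₆ = inj₂ (record
    { i≤k∸a = p₁ ; i≤k∸b = p₂ ; k∸b∸i≤a = p₃ ; i≤k∸c = p₄ ; k∸c∸i≤a = p₅ ; k≤b+c+i = p₆ })

  evalP-linear : ∀ m → k + a ≤ m → evalP linear (ℕtoℚ m) ≡ ℕtoℚ (m ∸ (k + a))
  evalP-linear m k+a≤m = trans (evalP-+P X (constP (ℚ.- ℕtoℚ (k + a))) (ℕtoℚ m))
    (trans (cong₂ ℚ._+_ (evalP-X (ℕtoℚ m)) (evalP-constP _ (ℕtoℚ m))) (ℕtoℚ-∸ m (k + a) k+a≤m))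

  module _ {i : ℕ} (s : Supported i) where
    open Supported s

    term-supported : term i ≡ binomConst (k ∸ a) i *P binomConst a (k ∸ b ∸ i) *P binomConst a (k ∸ c ∸ i)
                                *P binomN linear (termDegree i)
    term-supported = cong₂ _*P_ (cong₂ _*P_ (cong (outer i *P_) (middle-∸ i b≤k i≤k∸b)) (middle-∸ i c≤k i≤k∸c))
                               (binomZ-∸ linear {b + c + i} k≤b+c+i)

    topCoeff-term : TopCoeff (term i) (termDegree i) (termLead i)
    topCoeff-term = subst (λ p → TopCoeff p (termDegree i) (termLead i)) (sym term-supported)
      (topCoeff-*P (topCoeff-*P (topCoeff-*P (topCoeff-binomConst (k ∸ a) i)
                                             (topCoeff-binomConst a (k ∸ b ∸ i)))
                                (topCoeff-binomConst a (k ∸ c ∸ i)))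
                   (topCoeff-binomN-monic (topCoeff-X+constP (ℚ.- ℕtoℚ (k + a))) (termDegree i)))

    constantPart-pos : 0ℚ < constantPart i
    constantPart-pos = *-pos (*-pos (binomialℚ-pos (k ∸ a) i i≤k∸a) (binomialℚ-pos a (k ∸ b ∸ i) k∸b∸i≤a))
                             (binomialℚ-pos a (k ∸ c ∸ i) k∸c∸i≤a)

    termLead-pos : 0ℚ < termLead i
    termLead-pos = *-pos constantPart-pos (1/!-pos (termDegree i))

    termDegree≤b : termDegree i ≤ b
    termDegree≤b = m≤n+o⇒m∸n≤o (b + c + i) k (begin
      b + c + i   ≡⟨ +-assoc b c i ⟩
      b + (c + i) ≤⟨ +-monoʳ-≤ b (subst (_≤ k) (+-comm i c) (m≤o∸n⇒m+n≤o i c≤k i≤k∸c)) ⟩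
      b + k       ≡⟨ +-comm b k ⟩
      k + b       ∎)
      where open ≤-Reasoning

    evalP-term : ∀ m → k + a ≤ m → evalP (term i) (ℕtoℚ m)
      ≡ constantPart i ℚ.* (1/! (termDegree i) ℚ.* falling (ℕtoℚ (m ∸ (k + a))) (termDegree i))
    evalP-term m k+a≤m = begin
      evalP (term i) v
        ≡⟨ cong (λ p → evalP p v) term-supported ⟩
      evalP (B₁ *P B₂ *P B₃ *P binomN linear (termDegree i)) v
        ≡⟨ evalP-*P (B₁ *P B₂ *P B₃) (binomN linear (termDegree i)) v ⟩
      evalP (B₁ *P B₂ *P B₃) v ℚ.* evalP (binomN linear (termDegree i)) v
        ≡⟨ cong₂ ℚ._*_ (trans (evalP-*P (B₁ *P B₂) B₃ v)
                              (cong₂ ℚ._*_ (trans (evalP-*P B₁ B₂ v)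
                                                  (cong₂ ℚ._*_ (evalP-binomConst (k ∸ a) i v)
                                                               (evalP-binomConst a (k ∸ b ∸ i) v)))
                                           (evalP-binomConst a (k ∸ c ∸ i) v)))
                       (evalP-binomN linear (termDegree i) v) ⟩
      constantPart i ℚ.* (1/! (termDegree i) ℚ.* falling (evalP linear v) (termDegree i))
        ≡⟨ cong (λ w → constantPart i ℚ.* (1/! (termDegree i) ℚ.* falling w (termDegree i)))
                (evalP-linear m k+a≤m) ⟩
      constantPart i ℚ.* (1/! (termDegree i) ℚ.* falling (ℕtoℚ (m ∸ (k + a))) (termDegree i)) ∎
      where
      open ≡-Reasoning
      v  = ℕtoℚ m
      B₁ = binomConst (k ∸ a) i
      B₂ = binomConst a (k ∸ b ∸ i)
      B₃ = binomConst a (k ∸ c ∸ i)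

    term-eval-pos : ∀ m → 3 * k ≤ m → 0ℚ < evalP (term i) (ℕtoℚ m)
    term-eval-pos m 3k≤m = subst (0ℚ <_) (sym (evalP-term m (≤-trans (m≤n+m (k + a) k) k+[k+a]≤m)))
      (*-pos constantPart-pos (*-pos (1/!-pos (termDegree i)) (falling-ℕ-pos (m ∸ (k + a)) (termDegree i) degree≤)))
      where
      -- 3 * k unfolds to k + (k + (k + 0)).
      k+[k+a]≤m : k + (k + a) ≤ m
      k+[k+a]≤m = ≤-trans (+-monoʳ-≤ k (+-monoʳ-≤ k (subst (a ≤_) (sym (+-identityʳ k)) a≤k))) 3k≤m
      degree≤ : termDegree i ≤ m ∸ (k + a)
      degree≤ = ≤-trans termDegree≤b (≤-trans b≤k (m+n≤o⇒m≤o∸n k k+[k+a]≤m))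

  μ : ℕ
  μ = a ⊔ (b ⊔ c)

  μ≤k : μ ≤ k
  μ≤k = ⊔-lub a≤k (⊔-lub b≤k c≤k)

  top : ℕ
  top = k ∸ μ

  k∸x∸top≡μ∸x : ∀ x → k ∸ x ∸ top ≡ μ ∸ x
  k∸x∸top≡μ∸x x = begin
    k ∸ x ∸ top   ≡⟨ ∸-+-assoc k x top ⟩
    k ∸ (x + top) ≡⟨ cong (k ∸_) (+-comm x top) ⟩
    k ∸ (top + x) ≡⟨ ∸-+-assoc k top x ⟨
    k ∸ top ∸ x   ≡⟨ cong (_∸ x) (m∸[m∸n]≡n μ≤k) ⟩
    μ ∸ x         ∎
    where open ≡-Reasoning

  supported⇒triangle : ∀ {i} → Supported i → Triangle a b c
  supported⇒triangle {i} s = ≤+⇒triangle b≤c+a c≤b+a a≤b+c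
    where
    open Supported s
    b≤c+a : b ≤ c + a
    b≤c+a = +-cancelˡ-≤ i b (c + a)
              (≤-trans (m≤o∸n⇒m+n≤o i b≤k i≤k∸b) (m∸n∸o≤p⇒m≤o+[n+p] k c i a k∸c∸i≤a))
    c≤b+a : c ≤ b + a
    c≤b+a = +-cancelˡ-≤ i c (b + a)
              (≤-trans (m≤o∸n⇒m+n≤o i c≤k i≤k∸c) (m∸n∸o≤p⇒m≤o+[n+p] k b i a k∸b∸i≤a))
    a≤b+c : a ≤ b + c
    a≤b+c = +-cancelˡ-≤ i a (b + c)
              (≤-trans (m≤o∸n⇒m+n≤o i a≤k i≤k∸a) (subst (k ≤_) (+-comm (b + c) i) k≤b+c+i))

  supported⇒≤top : ∀ {i} → Supported i → i ≤ top
  supported⇒≤top {i} s = subst (i ≤_) k∸a⊓[k∸b⊓k∸c]≡top (⊓-glb i≤k∸a (⊓-glb i≤k∸b i≤k∸c))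
    where
    open Supported s
    k∸a⊓[k∸b⊓k∸c]≡top : (k ∸ a) ⊓ ((k ∸ b) ⊓ (k ∸ c)) ≡ top
    k∸a⊓[k∸b⊓k∸c]≡top = sym (trans (∸-distribˡ-⊔-⊓ k a (b ⊔ c)) (cong ((k ∸ a) ⊓_) (∸-distribˡ-⊔-⊓ k b c)))

  triangle⇒supported-top : Triangle a b c → Supported top
  triangle⇒supported-top t = record
    { i≤k∸a   = ∸-monoʳ-≤ k (m≤m⊔n a (b ⊔ c))
    ; i≤k∸b   = ∸-monoʳ-≤ k (≤-trans (m≤m⊔n b c) (m≤n⊔m a (b ⊔ c)))
    ; k∸b∸i≤a = subst (_≤ a) (sym (k∸x∸top≡μ∸x b)) (m≤n+o⇒m∸n≤o μ b μ≤b+a)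
    ; i≤k∸c   = ∸-monoʳ-≤ k (≤-trans (m≤n⊔m b c) (m≤n⊔m a (b ⊔ c)))
    ; k∸c∸i≤a = subst (_≤ a) (sym (k∸x∸top≡μ∸x c)) (m≤n+o⇒m∸n≤o μ c μ≤c+a)
    ; k≤b+c+i = subst (_≤ b + c + top) (m+[n∸m]≡n μ≤k) (+-monoˡ-≤ top μ≤b+c)
    }
    where
    sides = triangle⇒≤+ t
    μ≤b+a : μ ≤ b + a
    μ≤b+a = ⊔-lub (m≤n+m a b) (⊔-lub (m≤m+n b a) (proj₂ sides))
    μ≤c+a : μ ≤ c + a
    μ≤c+a = ⊔-lub (m≤n+m a c) (⊔-lub (proj₁ sides) (m≤m+n c a))
    μ≤b+c : μ ≤ b + c
    μ≤b+c = ⊔-lub (proj₂ t) (⊔-lub (m≤m+n b c) (m≤n+m c b))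

  degree : ℕ
  degree = b + c ∸ μ

  lead : ℚ
  lead = termLead top

  termDegree-top : termDegree top ≡ degree
  termDegree-top = begin
    b + c + top ∸ k           ≡⟨ cong₂ _∸_ (+-comm (b + c) top) (sym (m∸n+n≡m μ≤k)) ⟩
    top + (b + c) ∸ (top + μ) ≡⟨ [m+n]∸[m+o]≡n∸o top (b + c) μ ⟩
    b + c ∸ μ                 ∎
    where open ≡-Reasoning

  degree≤min : degree ≤ b ⊓ c
  degree≤min = subst (degree ≤_) (m+n∸[m⊔n]≡m⊓n b c) (∸-monoʳ-≤ (b + c) (m≤n⊔m a (b ⊔ c)))

  degree≡min⇔a≤max : Triangle a b c → (degree ≡ b ⊓ c ⇔ a ≤ b ⊔ c)
  degree≡min⇔a≤max t = mk⇔ to from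
    where
    μ≤b+c : μ ≤ b + c
    μ≤b+c = ⊔-lub (proj₂ t) (m⊔n≤m+n b c)
    to : degree ≡ b ⊓ c → a ≤ b ⊔ c
    to eq = subst (a ≤_) μ≡b⊔c (m≤m⊔n a (b ⊔ c))
      where
      μ≡b⊔c : μ ≡ b ⊔ c
      μ≡b⊔c = ∸-cancelˡ-≡ μ≤b+c (m⊔n≤m+n b c) (trans eq (sym (m+n∸[m⊔n]≡m⊓n b c)))
    from : a ≤ b ⊔ c → degree ≡ b ⊓ c
    from a≤b⊔c = trans (cong (b + c ∸_) (m≤n⇒m⊔n≡n a≤b⊔c)) (m+n∸[m⊔n]≡m⊓n b c)

  degree≡b⇒a≤b : Triangle a b c → c ≡ b → degree ≡ b → a ≤ b
  degree≡b⇒a≤b t c≡b degree≡b = subst (a ≤_) b⊔c≡b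
    (Equivalence.to (degree≡min⇔a≤max t) (trans degree≡b (sym b⊓c≡b)))
    where
    b⊔c≡b : b ⊔ c ≡ b
    b⊔c≡b = trans (cong (b ⊔_) c≡b) (⊔-idem b)
    b⊓c≡b : b ⊓ c ≡ b
    b⊓c≡b = trans (cong (b ⊓_) c≡b) (⊓-idem b)

  topCoeff-pJ : Triangle a b c → TopCoeff (pJ k a b c) degree lead
  topCoeff-pJ t = sumP-topCoeff (suc k) term top (s≤s (m∸n≤m k μ))
    (topCoeff-cong termDegree-top refl (topCoeff-term (triangle⇒supported-top t))) lower
    where
    lower : ∀ i → i ℕ.< suc k → ¬ i ≡ top → VanishesFrom (term i) degree
    lower i _ i≢top with term-zero-or-supported i
    ... | inj₁ zero-term = vanishesFrom-mono (term i) z≤n zero-term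
    ... | inj₂ s = vanishesFrom-mono (term i) (subst (termDegree i ℕ.<_) termDegree-top termDegree-i<)
                     (TopCoeff.vanishes-above (topCoeff-term s))
      where
      termDegree-i< : termDegree i ℕ.< termDegree top
      termDegree-i< = ∸-monoˡ-< (+-monoʳ-< (b + c) (≤∧≢⇒< (supported⇒≤top s) i≢top)) (Supported.k≤b+c+i s)

  lead-pos : Triangle a b c → 0ℚ < lead
  lead-pos t = termLead-pos (triangle⇒supported-top t)

  pJ-eval-pos : Triangle a b c → ∀ m → 3 * k ≤ m → 0ℚ < evalP (pJ k a b c) (ℕtoℚ m)
  pJ-eval-pos t m 3k≤m = sumP-pos (suc k) term (ℕtoℚ m) top (s≤s (m∸n≤m k μ))
    (term-eval-pos (triangle⇒supported-top t) m 3k≤m) nonNeg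
    where
    nonNeg : ∀ i → i ℕ.< suc k → 0ℚ ℚ.≤ evalP (term i) (ℕtoℚ m)
    nonNeg i _ with term-zero-or-supported i
    ... | inj₁ zero-term = ℚₚ.≤-reflexive (sym (evalP-isZero (term i) (ℕtoℚ m) zero-term))
    ... | inj₂ s         = ℚₚ.<⇒≤ (term-eval-pos s m 3k≤m)

  pJ-zero : ¬ Triangle a b c → IsZeroPoly (pJ k a b c)
  pJ-zero ¬t = sumP-vanishesFrom (suc k) term 0 λ i _ → zero-term i
    where
    zero-term : ∀ i → IsZeroPoly (term i)
    zero-term i with term-zero-or-supported i
    ... | inj₁ z = z
    ... | inj₂ s = ⊥-elim (¬t (supported⇒triangle s))

  lead-diagonal : c ≡ b → a ≤ b → lead ≡ (+ ((k ∸ a) C (k ∸ b)) ℚ./ b !) {{b !≢0}}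
  lead-diagonal c≡b a≤b = begin
    termLead top
      ≡⟨ cong₂ ℚ._*_ (cong₂ ℚ._*_ (cong₂ ℚ._*_ (cong (binomialℚ (k ∸ a)) top≡k∸b)
                                             (cong (binomialℚ a) (trans (k∸x∸top≡μ∸x b) μ∸b≡0)))
                                (cong (binomialℚ a) (trans (k∸x∸top≡μ∸x c) (trans (cong (μ ∸_) c≡b) μ∸b≡0))))
                     (cong 1/! (trans termDegree-top degree≡b)) ⟩
    binomialℚ (k ∸ a) (k ∸ b) ℚ.* 1ℚ ℚ.* 1ℚ ℚ.* 1/! b    -- binomialℚ a 0 computes to 1ℚ
      ≡⟨ cong (λ x → x ℚ.* 1ℚ ℚ.* 1ℚ ℚ.* 1/! b) (binomialℚ≡C (k ∸ a) (k ∸ b) (∸-monoʳ-≤ k a≤b)) ⟩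
    ℕtoℚ binom ℚ.* 1ℚ ℚ.* 1ℚ ℚ.* 1/! b
      ≡⟨ solve 2 (λ x y → x :* con 1ℚ :* con 1ℚ :* y := x :* y) refl (ℕtoℚ binom) (1/! b) ⟩
    ℕtoℚ binom ℚ.* 1/! b
      ≡⟨ ℕtoℚ-*-/ binom 1 (b !) {{b !≢0}} ⟩
    (+ (binom * 1) ℚ./ b !) {{b !≢0}}
      ≡⟨ cong (λ n → (+ n ℚ./ b !) {{b !≢0}}) (*-identityʳ binom) ⟩
    (+ binom ℚ./ b !) {{b !≢0}} ∎
    where
    open ≡-Reasoning
    binom = (k ∸ a) C (k ∸ b)
    μ≡b : μ ≡ b
    μ≡b = trans (cong (λ x → a ⊔ (b ⊔ x)) c≡b) (trans (cong (a ⊔_) (⊔-idem b)) (m≤n⇒m⊔n≡n a≤b))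
    top≡k∸b : top ≡ k ∸ b
    top≡k∸b = cong (k ∸_) μ≡b
    μ∸b≡0 : μ ∸ b ≡ 0
    μ∸b≡0 = trans (cong (_∸ b) μ≡b) (n∸n≡0 b)
    degree≡b : degree ≡ b
    degree≡b = trans (cong₂ (λ x y → b + x ∸ y) c≡b μ≡b) (m+n∸n≡m b b)

-- The product over all coordinates

module Product {k d : ℕ} {a b c : Fin d → ℕ}
               (a≤k : ∀ i → a i ≤ k) (b≤k : ∀ i → b i ≤ k) (c≤k : ∀ i → c i ≤ k) where

  module Coord (i : Fin d) = Coordinate (a≤k i) (b≤k i) (c≤k i)

  P : Poly
  P = pVec k d a b c

  Triangles : Set
  Triangles = ∀ i → Triangle (a i) (b i) (c i)

  degrees : Fin d → ℕ
  degrees i = Coord.degree i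

  lead : ℚ
  lead = prodℚ d Coord.lead

  ¬isZero⇒triangles : ¬ IsZeroPoly P → Triangles
  ¬isZero⇒triangles nz i with triangle? (a i) (b i) (c i)
  ... | yes t = t
  ... | no ¬t = ⊥-elim (nz (prodP-isZero d (λ i → pJ k (a i) (b i) (c i)) i (Coord.pJ-zero i ¬t)))

  topCoeff-pVec : Triangles → TopCoeff P (wt degrees) lead
  topCoeff-pVec t =
    prodP-topCoeff d (λ i → pJ k (a i) (b i) (c i)) degrees Coord.lead λ i → Coord.topCoeff-pJ i (t i)

  degree-pVec : Triangles → Degree P (wt degrees)
  degree-pVec t = topCoeff⇒degree (topCoeff-pVec t)
    (λ lead≡0 → ℚₚ.<-irrefl (sym lead≡0) (prodℚ-pos d Coord.lead λ i → Coord.lead-pos i (t i)))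

  pVec-pos⇔triangles : ∀ m → 3 * k ≤ m → (0ℚ < evalP P (ℕtoℚ m) ⇔ Triangles)
  pVec-pos⇔triangles m 3k≤m = mk⇔
    (λ 0<P → ¬isZero⇒triangles λ z → ℚₚ.<-irrefl (sym (evalP-isZero P (ℕtoℚ m) z)) 0<P)
    (λ t → prodP-eval-pos d (λ i → pJ k (a i) (b i) (c i)) (ℕtoℚ m) λ i → Coord.pJ-eval-pos i (t i) m 3k≤m)

  pVec-degree : NonZeroPoly P
    → Σ ℕ (λ n → Degree P n × n ≤ wt (minV b c) × (n ≡ wt (minV b c) ⇔ a ≤V maxV b c))
  pVec-degree nz = wt degrees , degree-pVec t , wt-mono degrees (minV b c) degrees≤min , mk⇔ to from
    where
    t : Triangles
    t = ¬isZero⇒triangles (nonZero⇒¬isZero {P} nz)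
    degrees≤min : ∀ i → degrees i ≤ minV b c i
    degrees≤min i = Coord.degree≤min i
    to : wt degrees ≡ wt (minV b c) → a ≤V maxV b c
    to eq i = Equivalence.to (Coord.degree≡min⇔a≤max i (t i)) (wt-injective-≤ degrees (minV b c) degrees≤min eq i)
    from : a ≤V maxV b c → wt degrees ≡ wt (minV b c)
    from a≤max = wt-cong degrees (minV b c) λ i → Equivalence.from (Coord.degree≡min⇔a≤max i (t i)) (a≤max i)

  pVec-leading : Degree P (wt b) → wt b ≡ wt c
    → a ≤V b × (∀ i → b i ≡ c i) × coeff P (wt b) ≡ leadCoeff k d a b
  pVec-leading deg-b wb≡wc = a≤b , b≡c , coeff-lead
    where
    t : Triangles
    t = ¬isZero⇒triangles (nonZero⇒¬isZero {P} (wt b , proj₁ deg-b))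
    wt-degrees≡wt-b : wt degrees ≡ wt b
    wt-degrees≡wt-b = degree-unique P (degree-pVec t) deg-b
    degrees≡b : ∀ i → degrees i ≡ b i
    degrees≡b = wt-injective-≤ degrees b (λ i → ≤-trans (Coord.degree≤min i) (m⊓n≤m (b i) (c i))) wt-degrees≡wt-b
    degrees≡c : ∀ i → degrees i ≡ c i
    degrees≡c = wt-injective-≤ degrees c (λ i → ≤-trans (Coord.degree≤min i) (m⊓n≤n (b i) (c i)))
                               (trans wt-degrees≡wt-b wb≡wc)
    b≡c : ∀ i → b i ≡ c i
    b≡c i = trans (sym (degrees≡b i)) (degrees≡c i)
    a≤b : a ≤V b
    a≤b i = Coord.degree≡b⇒a≤b i (t i) (sym (b≡c i)) (degrees≡b i)
    coeff-lead : coeff P (wt b) ≡ leadCoeff k d a b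
    coeff-lead = trans (cong (coeff P) (sym wt-degrees≡wt-b))
      (trans (TopCoeff.coeff-top (topCoeff-pVec t))
             (prodℚ≡leadCoeff k d a b Coord.lead λ i → Coord.lead-diagonal i (sym (b≡c i)) (a≤b i)))

lemma3p2 : (k d : ℕ) → 1 ≤ k → 1 ≤ d → (a b c : Fin d → ℕ)
    → (∀ i → a i ≤ k) → (∀ i → b i ≤ k) → (∀ i → c i ≤ k)
    → ((m : ℕ) → 3 * k ≤ m
         → (0ℚ < evalP (pVec k d a b c) (ℕtoℚ m)
            ⇔ (∀ i → ∣ b i - c i ∣ ≤ a i × a i ≤ b i + c i)))
    × (NonZeroPoly (pVec k d a b c)
         → Σ ℕ (λ n → Degree (pVec k d a b c) n × n ≤ wt (minV b c)
              × (n ≡ wt (minV b c) ⇔ a ≤V maxV b c)))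
    × (Degree (pVec k d a b c) (wt b) → wt b ≡ wt c
         → a ≤V b × (∀ i → b i ≡ c i)
           × coeff (pVec k d a b c) (wt b) ≡ leadCoeff k d a b)
lemma3p2 k d _ _ a b c a≤k b≤k c≤k = pVec-pos⇔triangles , pVec-degree , pVec-leading
  where open Product a≤k b≤k c≤k
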